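{- Let $G$ be a connected non complete graph and $u,v$ two non adjacent vertices of $G$. Let $W=WT_G(u,v)$ and let $x\in V(G)\setminus (N[u]\cup N[v])$ be such that $xy\in E(G)$ for some $y\in W\setminus\{u,v\}$. Then $x\in W$.
   Context: All graphs are finite, simple, connected and have at least two vertices. $N[u]$ denotes the closed neighbourhood of $u$. For vertices $u,v$ of a graph $G$, a weakly toll walk between $u$ and $v$ is a sequence $u=w_0,w_1,\ldots,w_k=v$ ($k\ge 0$) such that, when $k>0$: $w_iw_{i+1}\in E(G)$ for all $i\in\{0,\ldots,k-1\}$; $uw_i\in E(G)$ with $i\in\{1,\ldots,k\}$ implies $w_i=w_1$; and $w_iv\in E(G)$ with $i\in\{0,\ldots,k-1\}$ implies $w_i=w_{k-1}$. $WT_G(u,v)$ is the set of vertices lying on some weakly toll walk between $u$ and $v$. -}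

module Defs where

open import Data.Nat using (ℕ; zero; suc; _≤_; _<_; _∸_)
open import Data.Fin using (Fin; zero; suc; inject₁; fromℕ; toℕ)
open import Data.Product using (Σ; ∃; _×_; _,_)
open import Relation.Binary.PropositionalEquality using (_≡_)
open import Relation.Nullary using (¬_)
open import Data.Sum using (_⊎_)
open import Level using (0ℓ)

record Graph (n : ℕ) : Set₁ where
  field
    Adj       : Fin n → Fin n → Set
    sym       : ∀ {x y} → Adj x y → Adj y x
    irrefl    : ∀ {x} → ¬ Adj x x

open Graph public

record Walk {n : ℕ} (G : Graph n) (a b : Fin n) : Set where
  field
    len   : ℕ
    vert  : Fin (suc len) → Fin n
    start : vert zero ≡ a
    end   : vert (fromℕ len) ≡ b
    step  : (i : Fin len) → Adj G (vert (inject₁ i)) (vert (suc i))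

open Walk public

Connected : {n : ℕ} → Graph n → Set
Connected G = ∀ a b → Walk G a b

InClosedNbhd : {n : ℕ} → Graph n → Fin n → Fin n → Set
InClosedNbhd G u x = x ≡ u ⊎ Adj G u x

-- For k = 0 both conditions are vacuous since i ranges over empty sets.
record WeaklyTollWalk {n : ℕ} (G : Graph n) (u v : Fin n) : Set where
  field
    walk  : Walk G u v
    tollU : ∀ (i j : Fin (suc (len walk))) → 1 ≤ toℕ i → toℕ j ≡ 1 →
            Adj G u (vert walk i) → vert walk i ≡ vert walk j
    tollV : ∀ (i j : Fin (suc (len walk))) → toℕ i < len walk → toℕ j ≡ len walk ∸ 1 →
            Adj G (vert walk i) v → vert walk i ≡ vert walk j

open WeaklyTollWalk public

InWT : {n : ℕ} → Graph n → Fin n → Fin n → Fin n → Set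
InWT G u v x = Σ (WeaklyTollWalk G u v) λ W → Σ (Fin (suc (len (walk W)))) λ i → vert (walk W) i ≡ x

-- Proof idea: take a weakly toll walk through y, say y = w_i with 0 < i < k (as y ≠ u, v),
-- and splice the excursion y, x, y into it at position i. The new walk visits no vertex
-- other than x that the old one did not, and it still starts with w_0 w_1 and ends with
-- w_(k-1) w_k; since x is adjacent to neither u nor v, both toll conditions survive.
module Submission where

open import Defs hiding (sym)
open import Data.Nat using (ℕ; zero; suc; _+_; _≤_; _<_; _∸_; z≤n; s≤s)
open import Data.Nat.Properties
  using (≤-refl; ≤-trans; <⇒≤; ≤-<-trans; <-≤-trans; ≤-pred; m≤n⇒m≤1+n; n≢0⇒n>0;
         ≤∧≢⇒<; m≤n⇒m<n∨m≡n; m+[n∸m]≡n; <⇒≤pred; m∸n≤m)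
open import Data.Fin using (Fin; zero; suc; toℕ; fromℕ<)
open import Data.Fin.Properties using (toℕ-fromℕ<; toℕ-fromℕ; toℕ-inject₁; toℕ<n; toℕ≤pred[n])
open import Data.Product using (∃; _×_; _,_)
open import Data.Sum using (inj₁; inj₂)
open import Data.Empty using (⊥-elim)
open import Function using (_∘_)
open import Relation.Binary.PropositionalEquality
  using (_≡_; _≢_; refl; sym; trans; cong; subst; subst₂; module ≡-Reasoning)
open import Relation.Nullary using (¬_)

module _ {a} {A : Set a} where

  -- f read as a sequence on ℕ; the value d at positions ≥ k is junk.
  extend : {k : ℕ} → A → (Fin k → A) → ℕ → A
  extend {zero}  d f m       = d
  extend {suc k} d f zero    = f zero
  extend {suc k} d f (suc m) = extend d (f ∘ suc) m

  extend-toℕ : {k : ℕ} (d : A) (f : Fin k → A) (q : Fin k) → extend d f (toℕ q) ≡ f q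
  extend-toℕ d f zero    = refl
  extend-toℕ d f (suc q) = extend-toℕ d (f ∘ suc) q

  extend-at : {k m : ℕ} (d : A) (f : Fin k → A) {q : Fin k} → toℕ q ≡ m → extend d f m ≡ f q
  extend-at d f {q} refl = extend-toℕ d f q

-- w 0, …, w k is a weakly toll walk from u to v. Indexing by ℕ rather than Fin (suc k)
-- lets the splicing below change the length without any Fin arithmetic.
record IsWeaklyTollSequence {n : ℕ} (G : Graph n) (u v : Fin n) (k : ℕ) (w : ℕ → Fin n) : Set where
  field
    start : w 0 ≡ u
    end   : w k ≡ v
    step  : ∀ m → m < k → Adj G (w m) (w (suc m))
    tollU : ∀ m → 1 ≤ m → m ≤ k → Adj G u (w m) → w m ≡ w 1
    tollV : ∀ m → m < k → Adj G (w m) v → w m ≡ w (k ∸ 1)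

module _ {n : ℕ} {G : Graph n} {u v : Fin n} where

  toWeaklyTollWalk : ∀ {k w} → IsWeaklyTollSequence G u v k w → WeaklyTollWalk G u v
  toWeaklyTollWalk {k} {w} T = record
    { walk  = record
      { len   = k
      ; vert  = w ∘ toℕ
      ; start = T.start
      ; end   = trans (cong w (toℕ-fromℕ k)) T.end
      ; step  = λ q → subst (λ m → Adj G (w m) (w (suc (toℕ q)))) (sym (toℕ-inject₁ q))
                        (T.step (toℕ q) (toℕ<n q))
      }
    ; tollU = λ i j 1≤i j≡1 u∼wi → trans (T.tollU (toℕ i) 1≤i (toℕ≤pred[n] i) u∼wi) (cong w (sym j≡1))
    ; tollV = λ i j i<k j≡k-1 wi∼v → trans (T.tollV (toℕ i) i<k wi∼v) (cong w (sym j≡k-1))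
    }
    where module T = IsWeaklyTollSequence T

  fromWeaklyTollWalk : (W : WeaklyTollWalk G u v) →
                       IsWeaklyTollSequence G u v (len (walk W)) (extend u (vert (walk W)))
  fromWeaklyTollWalk W = record
    { start = start (walk W)
    ; end   = trans (extend-at u f (toℕ-fromℕ k)) (end (walk W))
    ; step  = step′
    ; tollU = tollU′
    ; tollV = tollV′
    }
    where
    k = len (walk W)
    f = vert (walk W)
    w = extend u f
    open ≡-Reasoning

    step′ : ∀ m → m < k → Adj G (w m) (w (suc m))
    step′ m m<k = subst₂ (Adj G)
      (sym (extend-at u f (trans (toℕ-inject₁ q) (toℕ-fromℕ< m<k))))
      (sym (extend-at u f (cong suc (toℕ-fromℕ< m<k))))
      (step (walk W) q)
      where q = fromℕ< m<k

    tollU′ : ∀ m → 1 ≤ m → m ≤ k → Adj G u (w m) → w m ≡ w 1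
    tollU′ m 1≤m m≤k u∼wm = begin
      w m  ≡⟨ extend-at u f q≡m ⟩
      f q  ≡⟨ tollU W q j (subst (1 ≤_) (sym q≡m) 1≤m) j≡1
                (subst (Adj G u) (extend-at u f q≡m) u∼wm) ⟩
      f j  ≡⟨ extend-at u f j≡1 ⟨
      w 1  ∎
      where
      q = fromℕ< (s≤s m≤k)
      j = fromℕ< (s≤s (≤-trans 1≤m m≤k))
      q≡m = toℕ-fromℕ< (s≤s m≤k)
      j≡1 = toℕ-fromℕ< (s≤s (≤-trans 1≤m m≤k))

    tollV′ : ∀ m → m < k → Adj G (w m) v → w m ≡ w (k ∸ 1)
    tollV′ m m<k wm∼v = begin
      w m  ≡⟨ extend-at u f q≡m ⟩
      f q  ≡⟨ tollV W q j (subst (_< k) (sym q≡m) m<k) j≡k-1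
                (subst (λ z → Adj G z v) (extend-at u f q≡m) wm∼v) ⟩
      f j  ≡⟨ extend-at u f j≡k-1 ⟨
      w (k ∸ 1) ∎
      where
      q = fromℕ< (m≤n⇒m≤1+n m<k)
      j = fromℕ< (s≤s (m∸n≤m k 1))
      q≡m = toℕ-fromℕ< (m≤n⇒m≤1+n m<k)
      j≡k-1 = toℕ-fromℕ< (s≤s (m∸n≤m k 1))

  sequence⇒InWT : ∀ {k w m} → IsWeaklyTollSequence G u v k w → m ≤ k → InWT G u v (w m)
  sequence⇒InWT {w = w} T m≤k = toWeaklyTollWalk T , fromℕ< (s≤s m≤k) , cong w (toℕ-fromℕ< (s≤s m≤k))

  InWT⇒sequence : ∀ {y} → InWT G u v y →
                  ∃ λ k → ∃ λ w → IsWeaklyTollSequence G u v k w × ∃ λ m → m ≤ k × w m ≡ y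
  InWT⇒sequence (W , q , wq≡y) =
    len (walk W) , extend u (vert (walk W)) , fromWeaklyTollWalk W ,
    toℕ q , toℕ≤pred[n] q , trans (extend-toℕ u (vert (walk W)) q) wq≡y

  interior : ∀ {k w m} → IsWeaklyTollSequence G u v k w → m ≤ k → w m ≢ u → w m ≢ v → 1 ≤ m × m < k
  interior {w = w} T m≤k wm≢u wm≢v =
    n≢0⇒n>0 (λ m≡0 → wm≢u (trans (cong w m≡0) T.start)) ,
    ≤∧≢⇒< m≤k (λ m≡k → wm≢v (trans (cong w m≡k) T.end))
    where module T = IsWeaklyTollSequence T

-- detour i x w is the sequence w 0, …, w i, x, w i, w (i + 1), …
detour : ∀ {a} {A : Set a} → ℕ → A → (ℕ → A) → ℕ → A
detour zero    x w zero          = w 0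
detour zero    x w (suc zero)    = x
detour zero    x w (suc (suc m)) = w m
detour (suc i) x w zero          = w 0
detour (suc i) x w (suc m)       = detour i x (w ∘ suc) m

module _ {a} {A : Set a} where

  detour-≤ : ∀ i {m} (x : A) (w : ℕ → A) → m ≤ i → detour i x w m ≡ w m
  detour-≤ zero    x w z≤n       = refl
  detour-≤ (suc i) x w z≤n       = refl
  detour-≤ (suc i) x w (s≤s m≤i) = detour-≤ i x (w ∘ suc) m≤i

  detour-excursion : ∀ i (x : A) (w : ℕ → A) → detour i x w (suc i) ≡ x
  detour-excursion zero    x w = refl
  detour-excursion (suc i) x w = detour-excursion i x (w ∘ suc)

  detour-after : ∀ i {m} (x : A) (w : ℕ → A) → i ≤ m → detour i x w (suc (suc m)) ≡ w m
  detour-after zero    x w z≤n       = refl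
  detour-after (suc i) x w (s≤s i≤m) = detour-after i x (w ∘ suc) i≤m

data DetourPosition (i : ℕ) : ℕ → Set where
  before    : ∀ {m} → m ≤ i → DetourPosition i m
  excursion : DetourPosition i (suc i)
  after     : ∀ {m} → i ≤ m → DetourPosition i (suc (suc m))

detourPosition : ∀ i m → DetourPosition i m
detourPosition zero    zero          = before z≤n
detourPosition zero    (suc zero)    = excursion
detourPosition zero    (suc (suc m)) = after z≤n
detourPosition (suc i) zero          = before z≤n
detourPosition (suc i) (suc m) with detourPosition i m
... | before m≤i = before (s≤s m≤i)
... | excursion  = excursion
... | after i≤m  = after (s≤s i≤m)

module _ {n : ℕ} {G : Graph n} {u v x : Fin n} {k : ℕ} {w : ℕ → Fin n} {i : ℕ} where

  detour-isWeaklyTollSequence : IsWeaklyTollSequence G u v k w → 1 ≤ i → i < k →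
    ¬ Adj G u x → ¬ Adj G x v → Adj G x (w i) →
    IsWeaklyTollSequence G u v (2 + k) (detour i x w)
  detour-isWeaklyTollSequence T 1≤i i<k u≁x x≁v x∼wi = record
    { start = trans (detour-≤ i x w z≤n) T.start
    ; end   = trans (detour-after i x w (<⇒≤ i<k)) T.end
    ; step  = step′
    ; tollU = tollU′
    ; tollV = tollV′
    }
    where
    module T = IsWeaklyTollSequence T
    g = detour i x w

    step′ : ∀ m → m < 2 + k → Adj G (g m) (g (suc m))
    step′ m m<k+2 with detourPosition i m
    ... | before m≤i with m≤n⇒m<n∨m≡n m≤i
    ...   | inj₁ m<i rewrite detour-≤ i x w (<⇒≤ m<i) | detour-≤ i x w m<i =
      T.step m (<-≤-trans m<i (<⇒≤ i<k))
    ...   | inj₂ refl rewrite detour-≤ i x w ≤-refl | detour-excursion i x w = Graph.sym G x∼wi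
    step′ m m<k+2 | excursion rewrite detour-excursion i x w | detour-after i x w ≤-refl = x∼wi
    step′ m m<k+2 | after {m′} i≤m′
      rewrite detour-after i x w i≤m′ | detour-after i x w (m≤n⇒m≤1+n i≤m′) =
      T.step m′ (≤-pred (≤-pred m<k+2))

    tollU′ : ∀ m → 1 ≤ m → m ≤ 2 + k → Adj G u (g m) → g m ≡ g 1
    tollU′ m 1≤m m≤k+2 u∼gm rewrite detour-≤ i x w 1≤i with detourPosition i m
    ... | before m≤i rewrite detour-≤ i x w m≤i = T.tollU m 1≤m (≤-trans m≤i (<⇒≤ i<k)) u∼gm
    ... | excursion rewrite detour-excursion i x w = ⊥-elim (u≁x u∼gm)
    ... | after {m′} i≤m′ rewrite detour-after i x w i≤m′ =
      T.tollU m′ (≤-trans 1≤i i≤m′) (≤-pred (≤-pred m≤k+2)) u∼gm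

    penultimate : g (suc k) ≡ w (k ∸ 1)
    penultimate = trans (cong (g ∘ suc) (sym (m+[n∸m]≡n (≤-trans 1≤i (<⇒≤ i<k)))))
                        (detour-after i x w (<⇒≤pred i<k))

    tollV′ : ∀ m → m < 2 + k → Adj G (g m) v → g m ≡ g (suc k)
    tollV′ m m<k+2 gm∼v rewrite penultimate with detourPosition i m
    ... | before m≤i rewrite detour-≤ i x w m≤i = T.tollV m (≤-<-trans m≤i i<k) gm∼v
    ... | excursion rewrite detour-excursion i x w = ⊥-elim (x≁v gm∼v)
    ... | after {m′} i≤m′ rewrite detour-after i x w i≤m′ =
      T.tollV m′ (≤-pred (≤-pred m<k+2)) gm∼v

mainTheorem8 : {n : ℕ} (G : Graph n) → Connected G →
    (u v : Fin n) → u ≢ v → ¬ Adj G u v →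
    (x : Fin n) → ¬ InClosedNbhd G u x → ¬ InClosedNbhd G v x →
    (y : Fin n) → InWT G u v y → y ≢ u → y ≢ v → Adj G x y →
    InWT G u v x
mainTheorem8 G _ u v _ _ x x∉N[u] x∉N[v] y y∈WT y≢u y≢v x∼y with InWT⇒sequence y∈WT
... | k , w , T , i , i≤k , refl with interior T i≤k y≢u y≢v
...   | 1≤i , i<k =
  subst (InWT G u v) (detour-excursion i x w)
    (sequence⇒InWT
      (detour-isWeaklyTollSequence T 1≤i i<k (x∉N[u] ∘ inj₂) (x∉N[v] ∘ inj₂ ∘ Graph.sym G) x∼y)
      (s≤s (m≤n⇒m≤1+n (<⇒≤ i<k))))
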